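{- Let $\sigma,\tau\in\mathsf{Sym}_n$, let $S\subseteq[n]$ be fixed and $C=[n]\setminus S$, and suppose $\sigma(i)=\tau(i)$ for all $i\in C$. For a permutation $\pi\in\mathsf{Sym}_n$ let $d_\pi$ be the number of pairs $(i,j)$ with $i\in S$, $j\in C$ such that either ($i<j$ and $\pi(i)>\pi(j)$) or ($i>j$ and $\pi(i)<\pi(j)$). Then $d_\sigma \equiv d_\tau \pmod 2$.
   Context: $\mathsf{Sym}_n$ is the symmetric group on $[n]=\{1,\dots,n\}$. -}

module Defs where

open import Data.Nat using (ℕ; _+_)
open import Data.Bool using (Bool; true; false; if_then_else_; _∧_; _∨_; not)
open import Data.Fin using (Fin; _<?_)
open import Data.Fin.Subset using (Subset; _∈_; _∉_)
open import Data.Fin.Subset.Properties using (_∈?_)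
open import Data.Fin.Permutation using (Permutation′; _⟨$⟩ʳ_)
open import Data.List using (List; map; allFin)
open import Data.Nat.ListAction using (sum)
open import Relation.Nullary.Decidable using (⌊_⌋)

inS : ∀ {n} → Subset n → Fin n → Bool
inS S i = ⌊ i ∈? S ⌋

ltB : ∀ {n} → Fin n → Fin n → Bool
ltB i j = ⌊ i <? j ⌋

counted : ∀ {n} → Subset n → Permutation′ n → Fin n → Fin n → Bool
counted S π i j =
  inS S i ∧ not (inS S j) ∧
  ((ltB i j ∧ ltB (π ⟨$⟩ʳ j) (π ⟨$⟩ʳ i)) ∨ (ltB j i ∧ ltB (π ⟨$⟩ʳ i) (π ⟨$⟩ʳ j)))

d : ∀ {n} → Subset n → Permutation′ n → ℕ
d {n} S π = sum (map (λ i → sum (map (λ j → if counted S π i j then 1 else 0) (allFin n))) (allFin n))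

{-# OPTIONS --safe #-}
-- For i ∈ S and j ∈ C we have i ≠ j and σ(i) ≠ σ(j), so a pair is counted exactly when
-- [i < j] and [σ(i) < σ(j)] differ; hence d_σ ≡ A + B_σ (mod 2), where A counts the pairs
-- with i < j and B_σ those with σ(i) < σ(j). A does not involve σ. For fixed j ∈ C,
-- the number of i ∈ S with σ(i) < σ(j) is σ(j) minus the number of such i ∈ C, and
-- both terms are determined by σ restricted to C; so B_σ = B_τ.
module Submission where

open import Defs
open import Data.Nat using (ℕ; _%_; zero; suc; _+_; _*_)
open import Data.Nat.Properties using (+-*-semiring; +-identityʳ; +-cancelʳ-≡)
open import Data.Nat.DivMod using ([m+kn]%n≡m%n)
import Data.Nat.ListAction as List
open import Data.Bool using (Bool; true; false; if_then_else_; _∧_; _∨_; _xor_; not)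
open import Data.Fin using (Fin; _<?_)
open import Data.Fin.Properties using (<-asym; <-cmp)
open import Data.Fin.Subset using (Subset; _∉_)
open import Data.Fin.Subset.Properties using (_∈?_)
open import Data.Fin.Permutation using (Permutation′; _⟨$⟩ʳ_)
open import Data.List using (map; allFin; tabulate)
open import Data.List.Properties using (map-tabulate)
open import Function using (_∘_)
open import Function.Bundles using (Injection)
open import Function.Properties.Inverse using (↔⇒↣)
open import Relation.Nullary using (yes; no; contradiction)
open import Relation.Binary.Definitions using (tri<; tri≈; tri>)
open import Relation.Binary.PropositionalEquality
open import Algebra.Properties.Semiring.Sum +-*-semiring
  using (sum; sum-syntax; sum-cong-≗; ∑-distrib-+; ∑-comm; ∑-permute; *-distribʳ-sum)
open ≡-Reasoning

𝟙 : Bool → ℕ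
𝟙 b = if b then 1 else 0

count : ∀ {n} → (Fin n → Bool) → ℕ
count {n} P = ∑[ i < n ] 𝟙 (P i)

sum-tabulate : ∀ {n} (f : Fin n → ℕ) → List.sum (tabulate f) ≡ sum f
sum-tabulate {zero}  f = refl
sum-tabulate {suc n} f = cong (f Fin.zero +_) (sum-tabulate (λ i → f (Fin.suc i)))

sum-map-allFin : ∀ {n} (f : Fin n → ℕ) → List.sum (map f (allFin n)) ≡ sum f
sum-map-allFin f = trans (cong List.sum (map-tabulate (λ i → i) f)) (sum-tabulate f)

count-permute : ∀ {n} (π : Permutation′ n) (P : Fin n → Bool) →
                count (λ i → P (π ⟨$⟩ʳ i)) ≡ count P
count-permute π P = sym (∑-permute (λ i → 𝟙 (P i)) π)

count-split : ∀ {n} (Q P : Fin n → Bool) →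
              count (λ i → Q i ∧ P i) + count (λ i → not (Q i) ∧ P i) ≡ count P
count-split Q P = trans (sym (∑-distrib-+ (λ i → 𝟙 (Q i ∧ P i)) (λ i → 𝟙 (not (Q i) ∧ P i))))
                        (sum-cong-≗ λ i → split (Q i) (P i))
  where
  split : ∀ q p → 𝟙 (q ∧ p) + 𝟙 (not q ∧ p) ≡ 𝟙 p
  split true  p = +-identityʳ (𝟙 p)
  split false p = refl

-- The count over S is the count over all of Fin n, which σ merely permutes, minus the count
-- over C, which only sees σ on C.
count-∈-agree : ∀ {n} (S : Subset n) (σ τ : Permutation′ n) →
                (∀ i → i ∉ S → σ ⟨$⟩ʳ i ≡ τ ⟨$⟩ʳ i) → (P : Fin n → Bool) →
                count (λ i → inS S i ∧ P (σ ⟨$⟩ʳ i)) ≡ count (λ i → inS S i ∧ P (τ ⟨$⟩ʳ i))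
count-∈-agree S σ τ agree P = +-cancelʳ-≡ _ _ _ (begin
  count (λ i → inS S i ∧ P (σ ⟨$⟩ʳ i)) + count (λ i → not (inS S i) ∧ P (σ ⟨$⟩ʳ i))
    ≡⟨ count-split (inS S) (λ i → P (σ ⟨$⟩ʳ i)) ⟩
  count (λ i → P (σ ⟨$⟩ʳ i))
    ≡⟨ trans (count-permute σ P) (sym (count-permute τ P)) ⟩
  count (λ i → P (τ ⟨$⟩ʳ i))
    ≡⟨ count-split (inS S) (λ i → P (τ ⟨$⟩ʳ i)) ⟨
  count (λ i → inS S i ∧ P (τ ⟨$⟩ʳ i)) + count (λ i → not (inS S i) ∧ P (τ ⟨$⟩ʳ i))
    ≡⟨ cong (count (λ i → inS S i ∧ P (τ ⟨$⟩ʳ i)) +_) (sum-cong-≗ outside) ⟨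
  count (λ i → inS S i ∧ P (τ ⟨$⟩ʳ i)) + count (λ i → not (inS S i) ∧ P (σ ⟨$⟩ʳ i)) ∎)
  where
  outside : ∀ i → 𝟙 (not (inS S i) ∧ P (σ ⟨$⟩ʳ i)) ≡ 𝟙 (not (inS S i) ∧ P (τ ⟨$⟩ʳ i))
  outside i with i ∈? S
  ... | yes _   = refl
  ... | no  i∉S = cong (λ k → 𝟙 (P k)) (agree i i∉S)

ltB-on : ∀ {n} → Permutation′ n → Fin n → Fin n → Bool
ltB-on π i j = ltB (π ⟨$⟩ʳ i) (π ⟨$⟩ʳ j)

ltB-flip : ∀ {n} {x y : Fin n} → x ≢ y → ltB y x ≡ not (ltB x y)
ltB-flip {x = x} {y} x≢y with x <? y | y <? x
... | yes x<y | yes y<x = contradiction y<x (<-asym x<y)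
... | yes _   | no  _   = refl
... | no  _   | yes _   = refl
... | no  x≮y | no  y≮x with <-cmp x y
...   | tri< x<y _   _   = contradiction x<y x≮y
...   | tri≈ _   x≡y _   = contradiction x≡y x≢y
...   | tri> _   _   y<x = contradiction y<x y≮x

∧-not-∨-not-∧ : ∀ a b → (a ∧ not b) ∨ (not a ∧ b) ≡ a xor b
∧-not-∨-not-∧ true  true  = refl
∧-not-∨-not-∧ true  false = refl
∧-not-∨-not-∧ false b     = refl

counted-xor : ∀ {n} (S : Subset n) (π : Permutation′ n) (i j : Fin n) →
              counted S π i j ≡ inS S i ∧ not (inS S j) ∧ (ltB i j xor ltB-on π i j)
counted-xor S π i j with i ∈? S | j ∈? S
... | no  _   | _       = refl
... | yes _   | yes _   = refl
... | yes i∈S | no  j∉S = begin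
  (ltB i j ∧ ltB (π ⟨$⟩ʳ j) (π ⟨$⟩ʳ i)) ∨ (ltB j i ∧ ltB (π ⟨$⟩ʳ i) (π ⟨$⟩ʳ j))
    ≡⟨ cong₂ (λ b a → (ltB i j ∧ b) ∨ (a ∧ ltB-on π i j))
             (ltB-flip (i≢j ∘ Injection.injective (↔⇒↣ π))) (ltB-flip i≢j) ⟩
  (ltB i j ∧ not (ltB-on π i j)) ∨ (not (ltB i j) ∧ ltB-on π i j)
    ≡⟨ ∧-not-∨-not-∧ (ltB i j) (ltB-on π i j) ⟩
  ltB i j xor ltB-on π i j ∎
  where
  i≢j : i ≢ j
  i≢j refl = j∉S i∈S

∑∑-distrib-+ : ∀ {m n} (f g : Fin m → Fin n → ℕ) →
               ∑[ i < m ] ∑[ j < n ] (f i j + g i j) ≡ ∑[ i < m ] ∑[ j < n ] f i j + ∑[ i < m ] ∑[ j < n ] g i j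
∑∑-distrib-+ {n = n} f g = trans (sum-cong-≗ λ i → ∑-distrib-+ (f i) (g i))
                                 (∑-distrib-+ (λ i → ∑[ j < n ] f i j) (λ i → ∑[ j < n ] g i j))

∑∑-distribʳ-* : ∀ {m n} k (f : Fin m → Fin n → ℕ) →
                (∑[ i < m ] ∑[ j < n ] f i j) * k ≡ ∑[ i < m ] ∑[ j < n ] (f i j * k)
∑∑-distribʳ-* {n = n} k f = trans (*-distribʳ-sum k (λ i → ∑[ j < n ] f i j))
                                  (sum-cong-≗ λ i → *-distribʳ-sum k (f i))

countCross : ∀ {n} → Subset n → (Fin n → Fin n → Bool) → ℕ
countCross {n} S P = ∑[ i < n ] ∑[ j < n ] 𝟙 (inS S i ∧ not (inS S j) ∧ P i j)

d≡countCross-xor : ∀ {n} (S : Subset n) (π : Permutation′ n) →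
                   d S π ≡ countCross S (λ i j → ltB i j xor ltB-on π i j)
d≡countCross-xor {n} S π =
  trans (sum-map-allFin (λ i → List.sum (map (λ j → 𝟙 (counted S π i j)) (allFin n)))) (sum-cong-≗ λ i →
  trans (sum-map-allFin (λ j → 𝟙 (counted S π i j))) (sum-cong-≗ λ j → cong 𝟙 (counted-xor S π i j)))

countCross-xor : ∀ {n} (S : Subset n) (P Q : Fin n → Fin n → Bool) →
                 countCross S (λ i j → P i j xor Q i j) + countCross S (λ i j → P i j ∧ Q i j) * 2
                   ≡ countCross S P + countCross S Q
countCross-xor {n} S P Q = begin
  countCross S (λ i j → P i j xor Q i j) + countCross S (λ i j → P i j ∧ Q i j) * 2
    ≡⟨ cong (countCross S (λ i j → P i j xor Q i j) +_) (∑∑-distribʳ-* 2 (λ i j → 𝟙 (onCross i j (P i j ∧ Q i j)))) ⟩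
  countCross S (λ i j → P i j xor Q i j) + ∑[ i < n ] ∑[ j < n ] (𝟙 (onCross i j (P i j ∧ Q i j)) * 2)
    ≡⟨ ∑∑-distrib-+ (λ i j → 𝟙 (onCross i j (P i j xor Q i j))) (λ i j → 𝟙 (onCross i j (P i j ∧ Q i j)) * 2) ⟨
  ∑[ i < n ] ∑[ j < n ] (𝟙 (onCross i j (P i j xor Q i j)) + 𝟙 (onCross i j (P i j ∧ Q i j)) * 2)
    ≡⟨ (sum-cong-≗ λ i → sum-cong-≗ λ j → 𝟙-xor (inS S i) (not (inS S j)) (P i j) (Q i j)) ⟩
  ∑[ i < n ] ∑[ j < n ] (𝟙 (onCross i j (P i j)) + 𝟙 (onCross i j (Q i j)))
    ≡⟨ ∑∑-distrib-+ (λ i j → 𝟙 (onCross i j (P i j))) (λ i j → 𝟙 (onCross i j (Q i j))) ⟩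
  countCross S P + countCross S Q ∎
  where
  onCross : Fin n → Fin n → Bool → Bool
  onCross i j b = inS S i ∧ not (inS S j) ∧ b

  𝟙-xor : ∀ g h a b → 𝟙 (g ∧ h ∧ (a xor b)) + 𝟙 (g ∧ h ∧ a ∧ b) * 2 ≡ 𝟙 (g ∧ h ∧ a) + 𝟙 (g ∧ h ∧ b)
  𝟙-xor false h     a     b     = refl
  𝟙-xor true  false a     b     = refl
  𝟙-xor true  true  true  true  = refl
  𝟙-xor true  true  true  false = refl
  𝟙-xor true  true  false true  = refl
  𝟙-xor true  true  false false = refl

countCross-ltB-on-agree : ∀ {n} (S : Subset n) (σ τ : Permutation′ n) →
                         (∀ i → i ∉ S → σ ⟨$⟩ʳ i ≡ τ ⟨$⟩ʳ i) →
                         countCross S (ltB-on σ) ≡ countCross S (ltB-on τ)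
countCross-ltB-on-agree {n} S σ τ agree = begin
  countCross S (ltB-on σ)             ≡⟨ ∑-comm (summand σ) ⟩
  ∑[ j < n ] ∑[ i < n ] summand σ i j ≡⟨ sum-cong-≗ column ⟩
  ∑[ j < n ] ∑[ i < n ] summand τ i j ≡⟨ ∑-comm (summand τ) ⟨
  countCross S (ltB-on τ)             ∎
  where
  summand : Permutation′ n → Fin n → Fin n → ℕ
  summand π i j = 𝟙 (inS S i ∧ not (inS S j) ∧ ltB-on π i j)

  column : ∀ j → count (λ i → inS S i ∧ not (inS S j) ∧ ltB (σ ⟨$⟩ʳ i) (σ ⟨$⟩ʳ j))
                 ≡ count (λ i → inS S i ∧ not (inS S j) ∧ ltB (τ ⟨$⟩ʳ i) (τ ⟨$⟩ʳ j))
  column j with j ∈? S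
  ... | yes _   = refl
  ... | no  j∉S = begin
    count (λ i → inS S i ∧ ltB (σ ⟨$⟩ʳ i) (σ ⟨$⟩ʳ j))
      ≡⟨ cong (λ v → count (λ i → inS S i ∧ ltB (σ ⟨$⟩ʳ i) v)) (agree j j∉S) ⟩
    count (λ i → inS S i ∧ ltB (σ ⟨$⟩ʳ i) (τ ⟨$⟩ʳ j))
      ≡⟨ count-∈-agree S σ τ agree (λ k → ltB k (τ ⟨$⟩ʳ j)) ⟩
    count (λ i → inS S i ∧ ltB (τ ⟨$⟩ʳ i) (τ ⟨$⟩ʳ j)) ∎

lemma3p1 : (n : ℕ) (σ τ : Permutation′ n) (S : Subset n) →
           (∀ (i : Fin n) → i ∉ S → σ ⟨$⟩ʳ i ≡ τ ⟨$⟩ʳ i) →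
           d S σ % 2 ≡ d S τ % 2
lemma3p1 n σ τ S agree = begin
  d S σ % 2                                         ≡⟨ [m+kn]%n≡m%n (d S σ) (both σ) 2 ⟨
  (d S σ + both σ * 2) % 2                          ≡⟨ cong (_% 2) (parity σ) ⟩
  (countCross S ltB + countCross S (ltB-on σ)) % 2
    ≡⟨ cong (λ b → (countCross S ltB + b) % 2) (countCross-ltB-on-agree S σ τ agree) ⟩
  (countCross S ltB + countCross S (ltB-on τ)) % 2 ≡⟨ cong (_% 2) (parity τ) ⟨
  (d S τ + both τ * 2) % 2                          ≡⟨ [m+kn]%n≡m%n (d S τ) (both τ) 2 ⟩
  d S τ % 2                                         ∎
  where
  both : Permutation′ n → ℕ
  both π = countCross S (λ i j → ltB i j ∧ ltB-on π i j)

  parity : ∀ π → d S π + both π * 2 ≡ countCross S ltB + countCross S (ltB-on π)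
  parity π = trans (cong (_+ both π * 2) (d≡countCross-xor S π)) (countCross-xor S ltB (ltB-on π))
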